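{- Run the colouring procedure (described in the context) on an Eulerian directed multigraph $G$ with start vertex $v_0$. Upon termination, the \textsc{Dashed} edges form a closed trail which includes $v_0$ as an endpoint (equivalently, the sequence of output edges is a closed trail through $v_0$, and the procedure terminates with $v_0$ as the current vertex).
   Context: $G=(V,E)$ is a finite directed multigraph (loops and parallel edges allowed), Eulerian: strongly connected and every vertex has in-degree equal to out-degree. Colouring procedure: each edge has a colour in $\{\textsc{Black},\textsc{Red},\textsc{Green},\textsc{Dashed}\}$, initially all \textsc{Black}. Choose a start vertex $v_0$; the current vertex is $u=v_0$, and $v_0$ is marked reached. Repeat: if some \textsc{Black} edge $wu$ enters the current vertex $u$, pick one, colour it \textsc{Red} if $w$ was not yet reached (and mark $w$ reached), otherwise \textsc{Green}, and make $w$ current. Otherwise: if some \textsc{Green} edge $uw$ leaves $u$, colour it \textsc{Dashed}, output it, make $w$ current; else if $u\ne v_0$, colour the unique \textsc{Red} edge $uw$ leaving $u$ \textsc{Dashed}, output it, make $w$ current; else ($u=v_0$) terminate. -}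

module Defs where

open import Data.Nat using (ℕ)
open import Data.Fin using (Fin; _≟_)
open import Data.List using (List; []; _∷_; _∷ʳ_; length; filter; allFin)
open import Data.List.Relation.Unary.Unique.Propositional using (Unique)
open import Data.Bool using (Bool; true; false; if_then_else_)
open import Data.Product using (∃; _×_)
open import Relation.Nullary using (¬_)
open import Relation.Nullary.Decidable using (⌊_⌋)
open import Relation.Binary.PropositionalEquality using (_≡_; _≢_)

record Multigraph : Set where
  field
    n   : ℕ
    m   : ℕ
    src : Fin m → Fin n
    tgt : Fin m → Fin n

data Colour : Set where
  black red green dashed : Colour

module _ (G : Multigraph) where
  open Multigraph G

  data Walk : Fin n → List (Fin m) → Fin n → Set where
    nil  : ∀ {u} → Walk u [] u
    cons : ∀ {u w e es} → src e ≡ u → Walk (tgt e) es w → Walk u (e ∷ es) w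

  StronglyConnected : Set
  StronglyConnected = ∀ u v → ∃ λ es → Walk u es v

  outDeg inDeg : Fin n → ℕ
  outDeg v = length (filter (λ e → src e ≟ v) (allFin m))
  inDeg  v = length (filter (λ e → tgt e ≟ v) (allFin m))

  Eulerian : Set
  Eulerian = StronglyConnected × (∀ v → inDeg v ≡ outDeg v)

  ClosedTrailAt : Fin n → List (Fin m) → Set
  ClosedTrailAt v es = Unique es × Walk v es v

  record State : Set where
    constructor mkState
    field
      colour  : Fin m → Colour
      reached : Fin n → Bool
      cur     : Fin n
      out     : List (Fin m)   -- output edges, in order of output
  open State public

  updE : (Fin m → Colour) → Fin m → Colour → Fin m → Colour
  updE f e c e' = if ⌊ e' ≟ e ⌋ then c else f e'

  updV : (Fin n → Bool) → Fin n → Bool → Fin n → Bool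
  updV f v b v' = if ⌊ v' ≟ v ⌋ then b else f v'

  initState : Fin n → State
  initState v₀ = mkState (λ _ → black) (λ v → ⌊ v ≟ v₀ ⌋) v₀ []

  NoBlackIn : State → Set
  NoBlackIn s = ∀ e → colour s e ≡ black → tgt e ≢ cur s

  NoGreenOut : State → Set
  NoGreenOut s = ∀ e → colour s e ≡ green → src e ≢ cur s

  data Step (v₀ : Fin n) : State → State → Set where
    backRed   : ∀ {s} e → colour s e ≡ black → tgt e ≡ cur s → reached s (src e) ≡ false →
                Step v₀ s (mkState (updE (colour s) e red) (updV (reached s) (src e) true)
                                   (src e) (out s))
    backGreen : ∀ {s} e → colour s e ≡ black → tgt e ≡ cur s → reached s (src e) ≡ true →
                Step v₀ s (mkState (updE (colour s) e green) (reached s) (src e) (out s))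
    fwdGreen  : ∀ {s} e → NoBlackIn s → colour s e ≡ green → src e ≡ cur s →
                Step v₀ s (mkState (updE (colour s) e dashed) (reached s) (tgt e) (out s ∷ʳ e))
    fwdRed    : ∀ {s} e → NoBlackIn s → NoGreenOut s → cur s ≢ v₀ →
                colour s e ≡ red → src e ≡ cur s →
                (∀ e' → colour s e' ≡ red → src e' ≡ cur s → e' ≡ e) →
                Step v₀ s (mkState (updE (colour s) e dashed) (reached s) (tgt e) (out s ∷ʳ e))

  Terminal : Fin n → State → Set
  Terminal v₀ s = NoBlackIn s × NoGreenOut s × cur s ≡ v₀

{-# OPTIONS --safe #-}
module Submission where

-- The output edges
-- always form a trail from v₀ to some vertex p, they are exactly the dashed
-- edges, and the black edges satisfy the balance
--   black-in-degree(x) + [x = p] = [x = current] + black-out-degree(x),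
-- which holds initially because G is Eulerian.  A backward step removes a
-- black edge entering the current vertex and moves to its source, keeping the
-- balance.  A forward step happens only when no black edge enters the current
-- vertex, and then the balance there forces current = p, so the new dashed
-- edge extends the trail.  At termination current = v₀ has no black edge
-- entering it, hence p = v₀ and the trail is closed.

open import Defs
open import Data.Fin using (Fin)
open import Data.Product using (_×_)
open import Data.List.Membership.Propositional using (_∈_)
open import Relation.Binary.PropositionalEquality using (_≡_)
open import Relation.Binary.Construct.Closure.ReflexiveTransitive using (Star)

open import Data.Bool using (Bool; true; false; _∧_; if_then_else_)
open import Data.Nat using (ℕ; zero; suc; _+_)
open import Data.Nat.Properties using (+-comm; +-assoc; +-cancelˡ-≡; 0≢1+n; +-0-commutativeMonoid)
open import Algebra.Properties.CommutativeMonoid.Sum +-0-commutativeMonoid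
  using (sum; sum-cong-≗; sum-remove; sum-replicate-zero)
open import Data.Fin using (_≟_; punchIn)
open import Data.Fin.Properties using (punchInᵢ≢i)
open import Data.List using (_∷ʳ_; length; filter; allFin; tabulate)
open import Data.List.Relation.Unary.All as All using ()
open import Data.List.Relation.Unary.AllPairs using ([]; _∷_)
open import Data.List.Relation.Unary.Any using (here)
open import Data.List.Relation.Unary.Unique.Propositional using (Unique)
open import Data.List.Relation.Unary.Unique.Propositional.Properties using (++⁺)
open import Data.List.Membership.Propositional.Properties using (∈-++⁺ˡ; ∈-++⁺ʳ; ∈-++⁻)
open import Data.Product using (_,_)
open import Data.Sum using (_⊎_; inj₁; inj₂)
open import Function using (_∘_; id)
open import Relation.Nullary using (¬_; yes; no; does; contradiction)
open import Relation.Unary using (Pred; Decidable)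
open import Relation.Binary using (Rel)
open import Relation.Binary.PropositionalEquality
  using (_≢_; _≗_; refl; sym; trans; cong; subst; module ≡-Reasoning)
open import Relation.Binary.Construct.Closure.ReflexiveTransitive using (fold)

open ≡-Reasoning

𝟙 : Bool → ℕ
𝟙 b = if b then 1 else 0

count : ∀ {k} → (Fin k → Bool) → ℕ
count p = sum (𝟙 ∘ p)

count-cong : ∀ {k} {p q : Fin k → Bool} → p ≗ q → count p ≡ count q
count-cong p≗q = sum-cong-≗ (cong 𝟙 ∘ p≗q)

count-false : ∀ {k} {p : Fin k → Bool} → (∀ i → p i ≡ false) → count p ≡ 0
count-false {k} p≡false = trans (count-cong p≡false) (sum-replicate-zero k)

count-updateAt : ∀ {k} {p q : Fin k → Bool} i → q i ≡ false → (∀ j → j ≢ i → p j ≡ q j) →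
                 count p ≡ 𝟙 (p i) + count q
count-updateAt {suc k} {p} {q} i qi≡false p≡q = begin
  count p                             ≡⟨ sum-remove {i = i} (𝟙 ∘ p) ⟩
  𝟙 (p i) + sum ((𝟙 ∘ p) ∘ punchIn i) ≡⟨ cong (𝟙 (p i) +_) (count-cong p≡q-off-i) ⟩
  𝟙 (p i) + sum ((𝟙 ∘ q) ∘ punchIn i) ≡⟨ cong (𝟙 (p i) +_) (sym count-q) ⟩
  𝟙 (p i) + count q                   ∎
  where
  p≡q-off-i : p ∘ punchIn i ≗ q ∘ punchIn i
  p≡q-off-i j = p≡q (punchIn i j) (punchInᵢ≢i i j)
  count-q : count q ≡ sum ((𝟙 ∘ q) ∘ punchIn i)
  count-q = trans (sum-remove {i = i} (𝟙 ∘ q)) (cong (λ b → 𝟙 b + sum ((𝟙 ∘ q) ∘ punchIn i)) qi≡false)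

length-filter-tabulate : ∀ {a p} {A : Set a} {P : Pred A p} (P? : Decidable P) {k} (f : Fin k → A) →
                         length (filter P? (tabulate f)) ≡ count (does ∘ P? ∘ f)
length-filter-tabulate P? {zero}  f = refl
length-filter-tabulate P? {suc k} f with does (P? (f Fin.zero))
... | true  = cong suc (length-filter-tabulate P? (f ∘ Fin.suc))
... | false = length-filter-tabulate P? (f ∘ Fin.suc)

Star-invariant : ∀ {a r p} {A : Set a} {R : Rel A r} (P : Pred A p) →
                 (∀ {x y} → R x y → P x → P y) → ∀ {x y} → Star R x y → P x → P y
Star-invariant P preserves = fold (λ x y → P x → P y) (λ r k → k ∘ preserves r) id

isBlack : Colour → Bool
isBlack black = true
isBlack _     = false

data Marked : Colour → Set where
  red   : Marked red
  green : Marked green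

Marked⇒¬black : ∀ {c} → Marked c → isBlack c ≡ false
Marked⇒¬black red   = refl
Marked⇒¬black green = refl

Marked⇒≢dashed : ∀ {c} → Marked c → c ≢ dashed
Marked⇒≢dashed red   ()
Marked⇒≢dashed green ()

module _ (G : Multigraph) where
  open Multigraph G

  updE-≡ : ∀ (f : Fin m → Colour) e c → updE G f e c e ≡ c
  updE-≡ f e c with e ≟ e
  ... | yes _   = refl
  ... | no e≢e = contradiction refl e≢e

  updE-≢ : ∀ (f : Fin m → Colour) {e e'} c → e' ≢ e → updE G f e c e' ≡ f e'
  updE-≢ f {e} {e'} c e'≢e with e' ≟ e
  ... | yes e'≡e = contradiction e'≡e e'≢e
  ... | no _     = refl

  updE⁻ : ∀ (f : Fin m → Colour) e {c d} e' → updE G f e c e' ≡ d → e' ≡ e ⊎ f e' ≡ d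
  updE⁻ f e e' eq with e' ≟ e
  ... | yes e'≡e = inj₁ e'≡e
  ... | no _     = inj₂ eq

  walk-∷ʳ : ∀ {u w es e} → Walk G u es w → src e ≡ w → Walk G u (es ∷ʳ e) (tgt e)
  walk-∷ʳ nil         src≡w = cons src≡w nil
  walk-∷ʳ (cons s≡u w) src≡w = cons s≡u (walk-∷ʳ w src≡w)

  δ : Fin n → Fin n → ℕ
  δ u x = 𝟙 (does (u ≟ x))

  δ-refl : ∀ u → δ u u ≡ 1
  δ-refl u with u ≟ u
  ... | yes _   = refl
  ... | no u≢u = contradiction refl u≢u

  δ≡suc⇒≡ : ∀ {u x k} → δ u x ≡ suc k → u ≡ x
  δ≡suc⇒≡ {u} {x} eq with u ≟ x
  ... | yes u≡x = u≡x
  ... | no _    = contradiction eq 0≢1+n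

  blackDegree : (Fin m → Fin n) → (Fin m → Colour) → Fin n → ℕ
  blackDegree end col x = count (λ e → isBlack (col e) ∧ does (end e ≟ x))

  blackDegree-allBlack : ∀ end x →
    blackDegree end (λ _ → black) x ≡ length (filter (λ e → end e ≟ x) (allFin m))
  blackDegree-allBlack end x = sym (length-filter-tabulate (λ e → end e ≟ x) id)

  blackDegree-updE : ∀ end col e {c} x → isBlack c ≡ false →
    blackDegree end col x ≡ 𝟙 (isBlack (col e) ∧ does (end e ≟ x)) + blackDegree end (updE G col e c) x
  blackDegree-updE end col e {c} x c¬black = count-updateAt e
    (cong (_∧ does (end e ≟ x)) (trans (cong isBlack (updE-≡ col e c)) c¬black))
    (λ e' e'≢e → cong (λ c' → isBlack c' ∧ does (end e' ≟ x)) (sym (updE-≢ col c e'≢e)))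

  blackDegree-updE-black : ∀ end col e {c} x → col e ≡ black → isBlack c ≡ false →
    blackDegree end col x ≡ δ (end e) x + blackDegree end (updE G col e c) x
  blackDegree-updE-black end col e x col-e≡black c¬black =
    trans (blackDegree-updE end col e x c¬black)
          (cong (λ c' → 𝟙 (isBlack c' ∧ does (end e ≟ x)) + blackDegree end (updE G col e _) x) col-e≡black)

  blackDegree-updE-¬black : ∀ end col e {c} x → isBlack (col e) ≡ false → isBlack c ≡ false →
    blackDegree end (updE G col e c) x ≡ blackDegree end col x
  blackDegree-updE-¬black end col e x col-e¬black c¬black =
    sym (trans (blackDegree-updE end col e x c¬black)
               (cong (λ b → 𝟙 (b ∧ does (end e ≟ x)) + blackDegree end (updE G col e _) x) col-e¬black))

  blackIn blackOut : (Fin m → Colour) → Fin n → ℕ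
  blackIn  = blackDegree tgt
  blackOut = blackDegree src

  NoBlackIn⇒blackIn≡0 : ∀ {s} → NoBlackIn G s → blackIn (colour s) (cur s) ≡ 0
  NoBlackIn⇒blackIn≡0 {s} noBlack = count-false entering-black≡false
    where
    entering-black≡false : ∀ e → isBlack (colour s e) ∧ does (tgt e ≟ cur s) ≡ false
    entering-black≡false e with colour s e in col-e | tgt e ≟ cur s
    ... | black  | yes tgt≡cur = contradiction tgt≡cur (noBlack e col-e)
    ... | black  | no _        = refl
    ... | red    | _           = refl
    ... | green  | _           = refl
    ... | dashed | _           = refl

  module _ (v₀ : Fin n) where

    record Invariant (s : State G) : Set where
      field
        trailEnd     : Fin n
        trail        : Walk G v₀ (out s) trailEnd
        trail-unique : Unique (out s)
        ∈out⇒dashed  : ∀ e → e ∈ out s → colour s e ≡ dashed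
        dashed⇒∈out  : ∀ e → colour s e ≡ dashed → e ∈ out s
        balanced     : ∀ x → blackIn (colour s) x + δ trailEnd x ≡ δ (cur s) x + blackOut (colour s) x
    open Invariant

    Invariant-init : Eulerian G → Invariant (initState G v₀)
    Invariant-init (_ , in≡out) = record
      { trailEnd     = v₀
      ; trail        = nil
      ; trail-unique = []
      ; ∈out⇒dashed  = λ _ ()
      ; dashed⇒∈out  = λ _ ()
      ; balanced     = λ x → begin
          blackIn allBlack x + δ v₀ x   ≡⟨ +-comm (blackIn allBlack x) (δ v₀ x) ⟩
          δ v₀ x + blackIn allBlack x   ≡⟨ cong (δ v₀ x +_) (allBlack-balanced x) ⟩
          δ v₀ x + blackOut allBlack x  ∎
      }
      where
      allBlack : Fin m → Colour
      allBlack _ = black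
      allBlack-balanced : ∀ x → blackIn allBlack x ≡ blackOut allBlack x
      allBlack-balanced x = trans (blackDegree-allBlack tgt x) (trans (in≡out x) (sym (blackDegree-allBlack src x)))

    cur≡trailEnd : ∀ {s} (I : Invariant s) → NoBlackIn G s → cur s ≡ trailEnd I
    cur≡trailEnd {s} I noBlack = sym (δ≡suc⇒≡ (begin
      δ p u                              ≡⟨ cong (_+ δ p u) (sym (NoBlackIn⇒blackIn≡0 {s} noBlack)) ⟩
      blackIn (colour s) u + δ p u       ≡⟨ balanced I u ⟩
      δ u u + blackOut (colour s) u      ≡⟨ cong (_+ blackOut (colour s) u) (δ-refl u) ⟩
      suc (blackOut (colour s) u)        ∎))
      where
      u = cur s
      p = trailEnd I

    NoBlackIn⇒blackIn≡blackOut : ∀ {s} → Invariant s → NoBlackIn G s →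
                                 ∀ x → blackIn (colour s) x ≡ blackOut (colour s) x
    NoBlackIn⇒blackIn≡blackOut {s} I noBlack x = +-cancelˡ-≡ (δ (cur s) x) _ _ (begin
      δ (cur s) x + blackIn (colour s) x      ≡⟨ +-comm (δ (cur s) x) (blackIn (colour s) x) ⟩
      blackIn (colour s) x + δ (cur s) x      ≡⟨ cong (λ v → blackIn (colour s) x + δ v x) (cur≡trailEnd I noBlack) ⟩
      blackIn (colour s) x + δ (trailEnd I) x ≡⟨ balanced I x ⟩
      δ (cur s) x + blackOut (colour s) x     ∎)

    Invariant-back : ∀ {s} e {c rc} → Marked c → colour s e ≡ black → tgt e ≡ cur s → Invariant s →
                     Invariant (mkState (updE G (colour s) e c) rc (src e) (out s))
    Invariant-back {s} e {c} marked col-e≡black tgt≡cur I = record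
      { trailEnd     = trailEnd I
      ; trail        = trail I
      ; trail-unique = trail-unique I
      ; ∈out⇒dashed  = λ e' e'∈out → trans (updE-≢ col c (dashed⇒≢e (∈out⇒dashed I e' e'∈out)))
                                           (∈out⇒dashed I e' e'∈out)
      ; dashed⇒∈out  = λ e' dashed' → dashed⇒∈out I e' (still-dashed dashed')
      ; balanced     = balanced'
      }
      where
      col = colour s
      col' = updE G col e c

      dashed⇒≢e : ∀ {e'} → col e' ≡ dashed → e' ≢ e
      dashed⇒≢e col-e'≡dashed refl with trans (sym col-e≡black) col-e'≡dashed
      ... | ()

      still-dashed : ∀ {e'} → col' e' ≡ dashed → col e' ≡ dashed
      still-dashed {e'} col'-e'≡dashed with updE⁻ col e e' col'-e'≡dashed
      ... | inj₂ col-e'≡dashed = col-e'≡dashed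
      ... | inj₁ refl = contradiction (trans (sym (updE-≡ col e c)) col'-e'≡dashed) (Marked⇒≢dashed marked)

      balanced' : ∀ x → blackIn col' x + δ (trailEnd I) x ≡ δ (src e) x + blackOut col' x
      balanced' x = +-cancelˡ-≡ (δ (cur s) x) _ _ (begin
        δ (cur s) x + (blackIn col' x + δ (trailEnd I) x) ≡⟨ sym (+-assoc (δ (cur s) x) _ _) ⟩
        δ (cur s) x + blackIn col' x + δ (trailEnd I) x   ≡⟨ cong (_+ δ (trailEnd I) x) (sym removed-in) ⟩
        blackIn col x + δ (trailEnd I) x                  ≡⟨ balanced I x ⟩
        δ (cur s) x + blackOut col x                      ≡⟨ cong (δ (cur s) x +_) removed-out ⟩
        δ (cur s) x + (δ (src e) x + blackOut col' x)     ∎)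
        where
        removed-in : blackIn col x ≡ δ (cur s) x + blackIn col' x
        removed-in = subst (λ v → blackIn col x ≡ δ v x + blackIn col' x) tgt≡cur
                           (blackDegree-updE-black tgt col e x col-e≡black (Marked⇒¬black marked))
        removed-out : blackOut col x ≡ δ (src e) x + blackOut col' x
        removed-out = blackDegree-updE-black src col e x col-e≡black (Marked⇒¬black marked)

    Invariant-forward : ∀ {s} e → NoBlackIn G s → Marked (colour s e) → src e ≡ cur s → Invariant s →
                        Invariant (mkState (updE G (colour s) e dashed) (reached s) (tgt e) (out s ∷ʳ e))
    Invariant-forward {s} e noBlack marked src≡cur I = record
      { trailEnd     = tgt e
      ; trail        = walk-∷ʳ (trail I) (trans src≡cur (cur≡trailEnd I noBlack))
      ; trail-unique = ++⁺ (trail-unique I) (All.[] ∷ []) (λ { (e∈out , here refl) → e∉out e∈out })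
      ; ∈out⇒dashed  = ∈out'⇒dashed
      ; dashed⇒∈out  = dashed⇒∈out'
      ; balanced     = balanced'
      }
      where
      col = colour s
      col' = updE G col e dashed

      e∉out : ¬ e ∈ out s
      e∉out = Marked⇒≢dashed marked ∘ ∈out⇒dashed I e

      ∈out'⇒dashed : ∀ e' → e' ∈ out s ∷ʳ e → col' e' ≡ dashed
      ∈out'⇒dashed e' e'∈out' with ∈-++⁻ (out s) e'∈out'
      ... | inj₁ e'∈out    = trans (updE-≢ col dashed (λ { refl → e∉out e'∈out })) (∈out⇒dashed I e' e'∈out)
      ... | inj₂ (here refl) = updE-≡ col e dashed

      dashed⇒∈out' : ∀ e' → col' e' ≡ dashed → e' ∈ out s ∷ʳ e
      dashed⇒∈out' e' col'-e'≡dashed with updE⁻ col e e' col'-e'≡dashed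
      ... | inj₁ refl           = ∈-++⁺ʳ (out s) (here refl)
      ... | inj₂ col-e'≡dashed = ∈-++⁺ˡ (dashed⇒∈out I e' col-e'≡dashed)

      unchanged : ∀ end x → blackDegree end col' x ≡ blackDegree end col x
      unchanged end x = blackDegree-updE-¬black end col e x (Marked⇒¬black marked) refl

      balanced' : ∀ x → blackIn col' x + δ (tgt e) x ≡ δ (tgt e) x + blackOut col' x
      balanced' x = begin
        blackIn col' x + δ (tgt e) x  ≡⟨ cong (_+ δ (tgt e) x) (unchanged tgt x) ⟩
        blackIn col x + δ (tgt e) x   ≡⟨ +-comm (blackIn col x) (δ (tgt e) x) ⟩
        δ (tgt e) x + blackIn col x   ≡⟨ cong (δ (tgt e) x +_) (NoBlackIn⇒blackIn≡blackOut I noBlack x) ⟩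
        δ (tgt e) x + blackOut col x  ≡⟨ cong (δ (tgt e) x +_) (sym (unchanged src x)) ⟩
        δ (tgt e) x + blackOut col' x ∎

    Invariant-step : ∀ {s t} → Step G v₀ s t → Invariant s → Invariant t
    Invariant-step (backRed   e col-e≡black tgt≡cur _)       = Invariant-back e red   col-e≡black tgt≡cur
    Invariant-step (backGreen e col-e≡black tgt≡cur _)       = Invariant-back e green col-e≡black tgt≡cur
    Invariant-step (fwdGreen  e noBlack col-e≡green src≡cur) =
      Invariant-forward e noBlack (subst Marked (sym col-e≡green) green) src≡cur
    Invariant-step (fwdRed e noBlack _ _ col-e≡red src≡cur _) =
      Invariant-forward e noBlack (subst Marked (sym col-e≡red) red) src≡cur

lemma7 : (G : Multigraph) → Eulerian G → (v₀ : Fin (Multigraph.n G)) → (s : State G) →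
         Star (Step G v₀) (initState G v₀) s → Terminal G v₀ s →
         ClosedTrailAt G v₀ (out s) × cur s ≡ v₀ ×
         (∀ e → colour s e ≡ dashed → e ∈ out s)
lemma7 G eulerian v₀ s run (noBlack , _ , cur≡v₀) =
  (trail-unique I , subst (Walk G v₀ (out s)) trailEnd≡v₀ (trail I)) , cur≡v₀ , dashed⇒∈out I
  where
  open Invariant
  I : Invariant G v₀ s
  I = Star-invariant (Invariant G v₀) (Invariant-step G v₀) run (Invariant-init G v₀ eulerian)
  trailEnd≡v₀ : trailEnd I ≡ v₀
  trailEnd≡v₀ = trans (sym (cur≡trailEnd G v₀ I noBlack)) cur≡v₀
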